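{- Let $G$ be a graph that is a tolerance graph and a trapezoid graph but not a bounded tolerance graph, and which has the smallest number of vertices among all such graphs; let $R$ be a canonical projection representation of $G$ and $u$ an unbounded vertex of $G$ in $R$. Let $Q_u=\{v : v\text{ unbounded in } R,\ N(v)\subset N(u)\}$. Then for every $v\in Q_u$, every covering vertex of $u$ is also a covering vertex of $v$. Furthermore, no vertex of $Q_u$ is a vertex of $V_0(u)$.
   Context: Graphs are finite, simple, undirected; $N(x)$ open neighbourhood, $N[x]=N(x)\cup\{x\}$, $\subset$ strict inclusion. Tolerance graph: there are closed real intervals $I_u$ and positive reals $t_u$ with $uv\in E$ iff $|I_u\cap I_v|\ge\min\{t_u,t_v\}$; bounded tolerance: possible with all $t_u\le|I_u|$. Trapezoid graph: intersection graph of trapezoids between two parallel lines, each with one side on each line. Projection representation: fix parallel horizontal lines $L_1$ (upper), $L_2$ (lower); each vertex $u$ gets either (bounded) a parallelogram $P_u$ with upper side $[L(u),R(u)]$ on $L_1$, lower side $[l(u),r(u)]$ on $L_2$, other sides parallel, or (unbounded) a segment from $l(u)=r(u)$ on $L_2$ to $L(u)=R(u)$ on $L_1$; $\phi_u\in(0,\pi)$ is the angle of the non-horizontal sides with the positive direction of $L_2$. Induced adjacency: two bounded vertices adjacent iff $P_u\cap P_v\ne\emptyset$; bounded $v$, unbounded $u$ adjacent iff $P_u\cap P_v\ne\emptyset$ and $\phi_v>\phi_u$; two unbounded never adjacent. $R$ represents $G$ if its induced graph is $G$; endpoints and slopes distinct. An unbounded vertex $v$ is inevitable if there is a vertex $x\neq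 v$ with $P_x\cap P_v\neq\emptyset$, $\phi_x<\phi_v$, $xv\notin E$; $R$ is canonical if all unbounded vertices are inevitable. Covering set $\mathcal C(u)=\{v\in V\setminus N[u]: N(u)\subseteq N(v)\}$, whose elements are the covering vertices of $u$; $V_0(u)$ is the set of connected components of $G\setminus N[u]$ containing a covering vertex of $u$.
   Formalization: All interval endpoints, tolerances and trapezoid corners of the tolerance, bounded tolerance and trapezoid representations, and all endpoints of the projection representation R, are rationals instead of reals. -}

module Defs where

open import Data.Nat using (ℕ) renaming (_<_ to _<ℕ_)
open import Data.Fin using (Fin)
open import Data.Bool using (Bool; true; false)
open import Data.Rational using (ℚ; 0ℚ; 1ℚ; _+_; _-_; _*_; _⊔_; _⊓_; _≤_; _<_)
open import Data.Product using (Σ; ∃; _×_; _,_)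
open import Data.Sum using (_⊎_)
open import Relation.Nullary using (¬_)
open import Relation.Binary.PropositionalEquality using (_≡_; _≢_)
open import Function.Bundles using (_⇔_)

record Graph (n : ℕ) : Set where
  field
    adj    : Fin n → Fin n → Bool
    sym    : ∀ u v → adj u v ≡ adj v u
    irrefl : ∀ u → adj u u ≡ false

open Graph public

Edge : ∀ {n} → Graph n → Fin n → Fin n → Set
Edge G u v = adj G u v ≡ true

record Interval : Set where
  field
    lo    : ℚ
    hi    : ℚ
    lo≤hi : lo ≤ hi

open Interval public

len : Interval → ℚ
len I = hi I - lo I

∣_∩_∣ : Interval → Interval → ℚ
∣ I ∩ J ∣ = 0ℚ ⊔ ((hi I ⊓ hi J) - (lo I ⊔ lo J))

record ToleranceRep {n : ℕ} (G : Graph n) : Set where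
  field
    I     : Fin n → Interval
    t     : Fin n → ℚ
    t-pos : ∀ u → 0ℚ < t u
    edge⇔ : ∀ u v → u ≢ v → (Edge G u v ⇔ (t u ⊓ t v ≤ ∣ I u ∩ I v ∣))

open ToleranceRep public

IsTolerance : ∀ {n} → Graph n → Set
IsTolerance G = ToleranceRep G

IsBoundedTolerance : ∀ {n} → Graph n → Set
IsBoundedTolerance G = Σ (ToleranceRep G) λ T → ∀ u → t T u ≤ len (I T u)

-- L₁ is the line y = 1, L₂ the line y = 0.
-- A trapezoid has upper side [top-l , top-r] on L₁ and lower side
-- [bot-l , bot-r] on L₂; it is the convex hull of these two segments.

record Trapezoid : Set where
  field
    top-l top-r bot-l bot-r : ℚ
    top-ok : top-l ≤ top-r
    bot-ok : bot-l ≤ bot-r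

open Trapezoid public

InQuad : (tl tr bl br : ℚ) → ℚ → ℚ → Set
InQuad tl tr bl br x y =
  (0ℚ ≤ y) × (y ≤ 1ℚ) ×
  ((((1ℚ - y) * bl) + (y * tl)) ≤ x) × (x ≤ (((1ℚ - y) * br) + (y * tr)))

InTrap : Trapezoid → ℚ → ℚ → Set
InTrap T = InQuad (top-l T) (top-r T) (bot-l T) (bot-r T)

TrapMeet : Trapezoid → Trapezoid → Set
TrapMeet T S = Σ ℚ λ x → Σ ℚ λ y → InTrap T x y × InTrap S x y

IsTrapezoid : ∀ {n} → Graph n → Set
IsTrapezoid {n} G = Σ (Fin n → Trapezoid) λ T →
  ∀ u v → u ≢ v → (Edge G u v ⇔ TrapMeet (T u) (T v))

Bad : ∀ {n} → Graph n → Set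
Bad G = IsTolerance G × IsTrapezoid G × ¬ IsBoundedTolerance G

MinimalBad : ∀ {n} → Graph n → Set
MinimalBad {n} G = Bad G × (∀ m → m <ℕ n → (H : Graph m) → ¬ Bad H)

-- L₁ : y = 1 (upper), L₂ : y = 0 (lower).
-- Vertex u: lower side [l u , r u] on L₂, upper side [L u , R u] on L₁.
-- Bounded: a parallelogram (R u - L u ≡ r u - l u, l u < r u).
-- Unbounded: the segment from (l u , 0) to (L u , 1), l u ≡ r u, L u ≡ R u.
-- The angle φ_u of the non-horizontal sides with the positive direction
-- of L₂ satisfies cot φ_u = L u - l u, so φ_u < φ_v iff
-- L v - l v < L u - l u (cot is strictly decreasing on (0,π)).

record ProjRep (n : ℕ) : Set where
  field
    l r L R   : Fin n → ℚ
    bounded   : Fin n → Bool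
    bnd-par   : ∀ u → bounded u ≡ true → R u - L u ≡ r u - l u
    bnd-lr    : ∀ u → bounded u ≡ true → l u < r u
    unb-l     : ∀ u → bounded u ≡ false → l u ≡ r u
    unb-L     : ∀ u → bounded u ≡ false → L u ≡ R u
    dist-l    : ∀ u v → u ≢ v → l u ≢ l v
    dist-r    : ∀ u v → u ≢ v → r u ≢ r v
    dist-lr   : ∀ u v → u ≢ v → l u ≢ r v
    dist-L    : ∀ u v → u ≢ v → L u ≢ L v
    dist-R    : ∀ u v → u ≢ v → R u ≢ R v
    dist-LR   : ∀ u v → u ≢ v → L u ≢ R v
    dist-φ    : ∀ u v → u ≢ v → (L u - l u) ≢ (L v - l v)

open ProjRep public

module _ {n : ℕ} (ρ : ProjRep n) where

  Unbounded : Fin n → Set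
  Unbounded u = bounded ρ u ≡ false

  Bounded : Fin n → Set
  Bounded u = bounded ρ u ≡ true

  InP : Fin n → ℚ → ℚ → Set
  InP u = InQuad (L ρ u) (R ρ u) (l ρ u) (r ρ u)

  Meet : Fin n → Fin n → Set
  Meet u v = Σ ℚ λ x → Σ ℚ λ y → InP u x y × InP v x y

  φ<  : Fin n → Fin n → Set
  φ< u v = (L ρ v - l ρ v) < (L ρ u - l ρ u)

  Induced : Fin n → Fin n → Set
  Induced u v =
      (Bounded u × Bounded v × Meet u v)
    ⊎ (Bounded u × Unbounded v × Meet u v × φ< v u)
    ⊎ (Unbounded u × Bounded v × Meet u v × φ< u v)

  Represents : Graph n → Set
  Represents G = ∀ u v → u ≢ v → (Edge G u v ⇔ Induced u v)

  Inevitable : Graph n → Fin n → Set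
  Inevitable G v = Unbounded v × Σ (Fin n) λ x →
    x ≢ v × Meet x v × φ< x v × ¬ Edge G x v

  Canonical : Graph n → Set
  Canonical G = ∀ v → Unbounded v → Inevitable G v

  InQ : Graph n → Fin n → Fin n → Set
  InQ G u v = Unbounded v ×
    (∀ w → Edge G v w → Edge G u w) ×
    Σ (Fin n) λ w → Edge G u w × ¬ Edge G v w

module _ {n : ℕ} (G : Graph n) where

  Covering : Fin n → Fin n → Set
  Covering u v = v ≢ u × ¬ Edge G u v × (∀ w → Edge G u w → Edge G v w)

  OutsideN[_] : Fin n → Fin n → Set
  OutsideN[ u ] v = v ≢ u × ¬ Edge G u v

  data Reach (u : Fin n) (a : Fin n) : Fin n → Set where
    here : OutsideN[ u ] a → Reach u a a
    step : ∀ {b c} → Reach u a b → Edge G b c → OutsideN[ u ] c → Reach u a c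

  InV₀ : Fin n → Fin n → Set
  InV₀ u v = Σ (Fin n) λ c → Covering u c × Reach u c v

{-# OPTIONS --safe #-}
-- Only N(v) ⊂ N(u) matters: a vertex missing a neighbour of u cannot cover u,
-- a covering vertex of u sees N(u) ⊇ N(v), and a neighbour of v outside N[u]
-- would lie in N(v) ⊆ N(u).
module Submission where

open import Defs
open import Data.Nat using (ℕ)
open import Data.Fin using (Fin)
open import Data.Product using (_×_; _,_; proj₂)
open import Relation.Nullary using (¬_)
open import Relation.Binary.PropositionalEquality using (refl; trans)

module _ {n : ℕ} (G : Graph n) where

  _⊆ᴺ_ : Fin n → Fin n → Set
  v ⊆ᴺ u = ∀ w → Edge G v w → Edge G u w

  Edge-sym : ∀ {a b} → Edge G a b → Edge G b a
  Edge-sym {a} {b} e = trans (sym G b a) e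

  Reach⇒OutsideN : ∀ {u a b} → Reach G u a b → OutsideN[_] G u b
  Reach⇒OutsideN (here o)     = o
  Reach⇒OutsideN (step _ _ o) = o

  ¬Covering-of-missing : ∀ {u v w} → Edge G u w → ¬ Edge G v w → ¬ Covering G u v
  ¬Covering-of-missing uw ¬vw (_ , _ , cov) = ¬vw (cov _ uw)

  Covering-⊆ᴺ : ∀ {u v c} → v ⊆ᴺ u → ¬ Covering G u v → Covering G u c → Covering G v c
  Covering-⊆ᴺ v⊆u ¬cov-v cov-c@(_ , ¬uc , u⊆c) =
      (λ { refl → ¬cov-v cov-c })
    , (λ vc → ¬uc (v⊆u _ vc))
    , (λ w vw → u⊆c w (v⊆u w vw))

  ¬InV₀-⊆ᴺ : ∀ {u v} → v ⊆ᴺ u → ¬ Covering G u v → ¬ InV₀ G u v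
  ¬InV₀-⊆ᴺ _   ¬cov-v (_ , cov-c , here _)    = ¬cov-v cov-c
  ¬InV₀-⊆ᴺ v⊆u _      (_ , _ , step r bv _) =
    proj₂ (Reach⇒OutsideN r) (v⊆u _ (Edge-sym bv))

lemma13 : ∀ {n} (G : Graph n) → MinimalBad G →
    (ρ : ProjRep n) → Represents ρ G → Canonical ρ G →
    (u : Fin n) → Unbounded ρ u →
    (∀ v → InQ ρ G u v → ∀ c → Covering G u c → Covering G v c)
    × (∀ v → InQ ρ G u v → ¬ InV₀ G u v)
lemma13 G _ ρ _ _ u _ =
    (λ { v (_ , v⊆u , _ , uw , ¬vw) c → Covering-⊆ᴺ G v⊆u (¬Covering-of-missing G uw ¬vw) })
  , (λ { v (_ , v⊆u , _ , uw , ¬vw) → ¬InV₀-⊆ᴺ G v⊆u (¬Covering-of-missing G uw ¬vw) })
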